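{- Let $(\Sigma,<)$ be a finite totally ordered alphabet, let $w\in\Sigma^+$, and let $(\ell_1,\ldots,\ell_h)$ be a non-increasing maximal chain for the prefix order in $\mathrm{CFL}_{in}(w)$, where $\ell_1$ is the first element of $\mathrm{CFL}_{in}(w)$. If $\ell_1\cdots\ell_h$ is not an inverse Lyndon word, then $h>2$ and there are $i,j$ with $1\le i<j<h$ such that: (1) $\ell_1=\ell_2=\cdots=\ell_i\neq\ell_{i+1}$; (2) $\ell_{i+1}\cdots\ell_j$ is a prefix of $\ell_1$; (3) $\ell_{i+1}\cdots\ell_{j+1}$ is not a prefix of $\ell_1$; (4) $\ell_1\ll\ell_{i+1}\cdots\ell_{j+1}$; more specifically, there are words $r,s,s'\in\Sigma^*$ and letters $a,b\in\Sigma$ with $a<b$ such that $\ell_1=\ell_{i+1}\cdots\ell_j\,ras$ and $\ell_{j+1}=rbs'$; (5) $p\overline p=\ell_1\cdots\ell_i\,\ell_{i+1}\cdots\ell_j\,rb$, where $(p,\overline p)$ is the canonical pair associated with $w$ (and $r,b$ are as in (4)).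
   Context: Words are elements of $\Sigma^*$; $\Sigma^+$ the nonempty words. Lexicographic order $\prec$: $x\prec y$ if $x$ is a proper prefix of $y$, or $x=ras$, $y=rbt$ with $a,b\in\Sigma$, $a<b$. For nonempty $x,y$, $x\ll y$ means $x\prec y$ and $x$ not a proper prefix of $y$. $x\ge_p y$ means $y$ is a prefix of $x$. The inverse order $<_{in}$: $b<_{in}a\iff a<b$; $\prec_{in}$ is the induced lexicographic order. An anti-Lyndon word is a nonempty primitive word strictly smaller for $\prec_{in}$ than all its other conjugates. $\mathrm{CFL}_{in}(w)$ is the unique sequence $(\ell_1,\ldots,\ell_n)$ of anti-Lyndon words with $w=\ell_1\cdots\ell_n$ and $\ell_1\succeq_{in}\cdots\succeq_{in}\ell_n$. A non-increasing maximal chain for the prefix order in $\mathrm{CFL}_{in}(w)=(\ell_1,\ldots,\ell_n)$ is a block $\ell_r,\ldots,\ell_t$ of consecutive factors ($r\le t$) with $\ell_r\ge_p\ell_{r+1}\ge_p\cdots\ge_p\ell_t$, such that $\ell_r$ is not a prefix of $\ell_{r-1}$ if $r>1$ and $\ell_{t+1}$ is not a prefix of $\ell_t$ if $t<n$. An inverse Lyndon word is a $u\in\Sigma^+$ with $s\prec u$ for every nonempty proper suffix $s$ of $u$. For $w=pv$ with $p$ an inverse Lyndon nonempty proper prefix of $w$, a bounded right extension of $p$ is a nonempty prefix $\overline p$ of $v$ such that $\overline p$ is inverse Lyndon, $pz'$ is inverse Lyndon for every proper nonempty prefix $z'$ of $\overline p$, $p\overline p$ is not inverse Lyndon, and $p\ll\overline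 p$. If $w$ is not an inverse Lyndon word there is exactly one such pair $(p,\overline p)$, called the canonical pair associated with $w$. -}

module Defs where

open import Data.Nat using (ℕ; zero; suc; _∸_; _+_)
open import Data.List using (List; []; _∷_; _++_; concat; replicate; take; drop; length)
open import Data.List.Relation.Unary.All using (All)
open import Data.List.Relation.Unary.Linked using (Linked)
open import Data.Product using (Σ; ∃; _×_; _,_)
open import Data.Sum using (_⊎_)
open import Relation.Binary.PropositionalEquality using (_≡_; _≢_)
open import Relation.Nullary using (¬_)
open import Function using (flip)

module Words {A : Set} (_<_ : A → A → Set) where

  Word : Set
  Word = List A

  Prefix : Word → Word → Set
  Prefix x y = ∃ λ z → x ++ z ≡ y

  ProperPrefix : Word → Word → Set
  ProperPrefix x y = ∃ λ z → z ≢ [] × x ++ z ≡ y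

  NonemptyProperSuffix : Word → Word → Set
  NonemptyProperSuffix s u = s ≢ [] × (∃ λ x → x ≢ [] × x ++ s ≡ u)

  Lex : (A → A → Set) → Word → Word → Set
  Lex R x y = ProperPrefix x y
            ⊎ (∃ λ r → ∃ λ a → ∃ λ s → ∃ λ b → ∃ λ t →
                 x ≡ r ++ (a ∷ s) × y ≡ r ++ (b ∷ t) × R a b)

  _≺_ : Word → Word → Set
  _≺_ = Lex _<_

  _≪_ : Word → Word → Set
  x ≪ y = x ≢ [] × y ≢ [] × x ≺ y × ¬ ProperPrefix x y

  _<in_ : A → A → Set
  _<in_ = flip _<_

  _≺in_ : Word → Word → Set
  _≺in_ = Lex _<in_

  _⪰in_ : Word → Word → Set
  x ⪰in y = y ≺in x ⊎ x ≡ y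

  Primitive : Word → Set
  Primitive w = ∀ (u : Word) (k : ℕ) → w ≡ concat (replicate k u) → k ≡ 1

  AntiLyndon : Word → Set
  AntiLyndon w = w ≢ [] × Primitive w
               × (∀ u v → w ≡ u ++ v → v ++ u ≢ w → w ≺in (v ++ u))

  IsCFLin : Word → List Word → Set
  IsCFLin w ls = All AntiLyndon ls × concat ls ≡ w × Linked _⪰in_ ls

  InvLyndon : Word → Set
  InvLyndon u = u ≢ [] × (∀ s → NonemptyProperSuffix s u → s ≺ u)

  BoundedRightExt : Word → Word → Word → Set
  BoundedRightExt p v pbar =
    pbar ≢ [] × Prefix pbar v × InvLyndon pbar
    × (∀ z' → z' ≢ [] → ProperPrefix z' pbar → InvLyndon (p ++ z'))
    × ¬ InvLyndon (p ++ pbar) × p ≪ pbar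

  CanonicalPair : Word → Word → Word → Set
  CanonicalPair w p pbar =
    ∃ λ v → w ≡ p ++ v × p ≢ [] × v ≢ [] × InvLyndon p × BoundedRightExt p v pbar

  -- 1-indexed access ℓ_k in a list of words (ℓ_0 = [] by convention, unused)
  at : List Word → ℕ → Word
  at []       _             = []
  at (x ∷ xs) zero          = []
  at (x ∷ xs) (suc zero)    = x
  at (x ∷ xs) (suc (suc k)) = at xs (suc k)

  -- seg c a b = ℓ_a ⋯ ℓ_b  (for 1 ≤ a ≤ b)
  seg : List Word → ℕ → ℕ → Word
  seg c a b = concat (take (suc b ∸ a) (drop (a ∸ 1) c))

  PrefixChain : List Word → Set
  PrefixChain c = Linked (λ x y → Prefix y x) c

  InitialMaximalChain : List Word → List Word → Set
  InitialMaximalChain ls c =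
    c ≢ [] × PrefixChain c
    × (∃ λ rest → ls ≡ c ++ rest
         × (∀ x xs → rest ≡ x ∷ xs → ¬ Prefix x (at c (length c))))

{-# OPTIONS --safe #-}
-- An anti-Lyndon word ℓ is primitive and unbordered, so each nonempty proper suffix of ℓ
-- differs from ℓ by a smaller letter at their first mismatch; hence every nonempty prefix of a
-- power of ℓ is inverse Lyndon.  Since ℓ₁⋯ℓ_h is not inverse Lyndon, after the run
-- ℓ₁ = ⋯ = ℓ_i the longest block ℓ_{i+1}⋯ℓ_j spelling a prefix X of ℓ₁ is followed by a factor
-- ℓ_{j+1}, and X is a proper prefix of ℓ₁ because ℓ₁ is unbordered.  Writing ℓ₁ = X t, the
-- suffix t mismatches ℓ₁ from below: t = r a s and ℓ₁ = r b ⋯ with a < b, and as ℓ_{j+1} is a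
-- prefix of ℓ₁ but X ℓ_{j+1} is not, ℓ_{j+1} = r b s′.  Now ℓ₁^i X r is a prefix of ℓ₁^{i+1}, so
-- all its nonempty prefixes are inverse Lyndon, while ℓ₁^i X r b is not: it is the shortest
-- prefix of w that is not inverse Lyndon, which is p p̄ for the canonical pair (p, p̄).
module Submission where

open import Defs
open import Data.Empty using (⊥-elim)
open import Data.Nat using (ℕ; zero; suc; _+_; _≤_; _<_; z≤n; s≤s)
open import Data.Nat.Properties using (≤-refl; ≤-trans; ≤-reflexive; <⇒≤; <⇒≱; <-irrefl; +-cancelˡ-≡)
open import Data.Nat.Induction using (<-wellFounded)
open import Induction.WellFounded using (Acc; acc)
open import Data.List using (List; []; _∷_; _++_; _∷ʳ_; [_]; length; concat; replicate; take; drop)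
open import Data.List.Properties
  using (++-assoc; ++-identityʳ; ++-identityʳ-unique; ++-identityˡ-unique; ++-conicalˡ; ++-conicalʳ;
         ∷-injective; ∷-injectiveʳ; length-++; length-++-comm; length-++-≤ʳ;
         concat-++; take-all; take++drop≡id; ≡-dec; ++-monoid)
open import Data.List.Reverse using (reverseView; []; _∶_∶ʳ_)
open import Data.List.Membership.Propositional using (_∈_)
open import Data.List.Relation.Unary.All as All using (All; []; _∷_)
import Data.List.Relation.Unary.All.Properties as AllP
open import Data.List.Relation.Unary.Linked.Properties using (Linked⇒All)
open import Data.Product as Product using (Σ; ∃; ∃₂; _×_; _,_; proj₁; proj₂)
open import Data.Sum as Sum using (_⊎_; inj₁; inj₂)
open import Function using (_∘_; flip)
open import Relation.Binary.Definitions using (Decidable; DecidableEquality; tri<; tri≈; tri>)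
open import Relation.Binary.PropositionalEquality
  using (_≡_; _≢_; refl; sym; trans; cong; cong₂; subst; module ≡-Reasoning)
open import Relation.Binary.Structures using (IsStrictTotalOrder)
open import Relation.Nullary using (¬_; Dec; yes; no)
open import Relation.Nullary.Decidable using (map′)
open import Tactic.MonoidSolver using (solve)

module _ {A : Set} where

  levi : ∀ (a b c d : List A) → a ++ b ≡ c ++ d →
         (∃ λ e → c ≡ a ++ e × b ≡ e ++ d) ⊎ (∃₂ λ x e → a ≡ c ++ x ∷ e × d ≡ x ∷ e ++ b)
  levi []      b c       d eq = inj₁ (c , refl , eq)
  levi (x ∷ a) b []      d eq = inj₂ (x , a , refl , sym eq)
  levi (x ∷ a) b (y ∷ c) d eq with ∷-injective eq
  ... | refl , eq′ = Sum.map (λ (e , p , q) → e , cong (x ∷_) p , q)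
                             (λ (x′ , e , p , q) → x′ , e , cong (x ∷_) p , q)
                             (levi a b c d eq′)

  ++-∷≢[] : ∀ (xs : List A) {y ys} → xs ++ y ∷ ys ≢ []
  ++-∷≢[] []      ()
  ++-∷≢[] (_ ∷ _) ()

  length-<-++ʳ : ∀ {z} (s : List A) → z ≢ [] → length s < length (z ++ s)
  length-<-++ʳ {[]}    s z≢[] = ⊥-elim (z≢[] refl)
  length-<-++ʳ {_ ∷ z} s _    = s≤s (length-++-≤ʳ s {z})

  length-<-++ˡ : ∀ (x : List A) {z} → z ≢ [] → length x < length (x ++ z)
  length-<-++ˡ x {z} z≢[] = subst (length x <_) (length-++-comm z x) (length-<-++ʳ x z≢[])

  take-length-++ : ∀ (xs ys : List A) → take (length xs) (xs ++ ys) ≡ xs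
  take-length-++ []       ys = refl
  take-length-++ (x ∷ xs) ys = cong (x ∷_) (take-length-++ xs ys)

  take-length-++-∷ : ∀ (xs : List A) y ys → take (suc (length xs)) (xs ++ y ∷ ys) ≡ xs ∷ʳ y
  take-length-++-∷ []       y ys = refl
  take-length-++-∷ (x ∷ xs) y ys = cong (x ∷_) (take-length-++-∷ xs y ys)

  concat-∷ʳ : ∀ (xss : List (List A)) xs → concat (xss ∷ʳ xs) ≡ concat xss ++ xs
  concat-∷ʳ xss xs = trans (sym (concat-++ xss [ xs ])) (cong (concat xss ++_) (++-identityʳ xs))

  power : List A → ℕ → List A
  power u n = concat (replicate n u)

  power-+ : ∀ u m n → power u (m + n) ≡ power u m ++ power u n
  power-+ u zero    n = refl
  power-+ u (suc m) n = trans (cong (u ++_) (power-+ u m n)) (sym (++-assoc u (power u m) (power u n)))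

  power-sucʳ : ∀ u n → power u (suc n) ≡ power u n ++ u
  power-sucʳ u zero    = ++-identityʳ u
  power-sucʳ u (suc n) = trans (cong (u ++_) (power-sucʳ u n)) (sym (++-assoc u (power u n) u))

  commuting⇒powers : ∀ (u v : List A) → u ++ v ≡ v ++ u →
                     ∃ λ r → ∃₂ λ m n → u ≡ power r m × v ≡ power r n
  commuting⇒powers u v = go u v (<-wellFounded _)
    where
    go : ∀ u v → Acc _<_ (length (u ++ v)) → u ++ v ≡ v ++ u →
         ∃ λ r → ∃₂ λ m n → u ≡ power r m × v ≡ power r n
    go []          v           _         _     = v , 0 , 1 , refl , sym (++-identityʳ v)
    go u@(_ ∷ _)   []          _         _     = u , 1 , 0 , sym (++-identityʳ u) , refl
    go u@(_ ∷ _)   v@(_ ∷ _)   (acc rec) uv≡vu with levi u v v u uv≡vu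
    ... | inj₁ (e , v≡ue , v≡eu) =
      let r , m , n , u≡rᵐ , e≡rⁿ =
            go u e (rec (subst (λ x → length x < length (u ++ v)) v≡ue (length-<-++ʳ {u} v (λ ()))))
               (trans (sym v≡ue) v≡eu)
      in r , m , m + n , u≡rᵐ , trans v≡ue (trans (cong₂ _++_ u≡rᵐ e≡rⁿ) (sym (power-+ r m n)))
    ... | inj₂ (x , e , u≡vxe , u≡xev) =
      let r , m , n , v≡rᵐ , xe≡rⁿ =
            go v (x ∷ e) (rec (subst (λ y → length y < length (u ++ v)) u≡vxe (length-<-++ˡ u {v} (λ ()))))
               (trans (sym u≡vxe) u≡xev)
      in r , m + n , m , trans u≡vxe (trans (cong₂ _++_ v≡rᵐ xe≡rⁿ) (sym (power-+ r m n))) , v≡rᵐ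

module _ {B : Set} where

  replicate-span : DecidableEquality B → ∀ x (L : List B) →
                   ∃ λ k → L ≡ replicate k x ⊎ ∃₂ λ y L′ → L ≡ replicate k x ++ y ∷ L′ × y ≢ x
  replicate-span _≟_ x [] = 0 , inj₁ refl
  replicate-span _≟_ x (y ∷ L) with y ≟ x
  ... | no y≢x = 0 , inj₂ (y , L , refl , y≢x)
  ... | yes refl with replicate-span _≟_ x L
  ...   | k , rest =
    suc k , Sum.map (cong (x ∷_)) (λ (z , L′ , eq , z≢x) → z , L′ , cong (x ∷_) eq , z≢x) rest

  module _ {P : List B → Set} (P? : ∀ u → Dec (P u)) where

    greedy-split : ∀ front (L : List (List B)) → P front →
                   ∃ λ d → P (front ++ concat d)
                     × (L ≡ d ⊎ ∃₂ λ y L′ → L ≡ d ++ y ∷ L′ × ¬ P ((front ++ concat d) ++ y))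
    greedy-split front [] p = [] , subst P (sym (++-identityʳ front)) p , inj₁ refl
    greedy-split front (y ∷ L) p with P? (front ++ y)
    ... | no ¬p = [] , subst P (sym (++-identityʳ front)) p
                , inj₂ (y , L , refl , subst (λ u → ¬ P (u ++ y)) (sym (++-identityʳ front)) ¬p)
    ... | yes p′ with greedy-split (front ++ y) L p′
    ...   | d , pd , rest =
      y ∷ d , subst P (++-assoc front y (concat d)) pd
      , Sum.map (cong (y ∷_))
                (λ (z , L′ , eq , ¬pz) →
                   z , L′ , cong (y ∷_) eq , subst (λ u → ¬ P (u ++ z)) (++-assoc front y (concat d)) ¬pz)
                rest

    minimal-suffix? : ∀ x → (∃₂ λ z s → z ++ s ≡ x × P s × (∀ z′ s′ → z′ ≢ [] → z′ ++ s′ ≡ s → ¬ P s′))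
                            ⊎ (∀ z s → z ++ s ≡ x → ¬ P s)
    minimal-suffix? [] with P? []
    ... | yes p = inj₁ ([] , [] , refl , p , λ { [] _ z′≢[] _ → ⊥-elim (z′≢[] refl) ; (_ ∷ _) _ _ () })
    ... | no ¬p = inj₂ λ { [] [] _ → ¬p ; [] (_ ∷ _) () ; (_ ∷ _) _ () }
    minimal-suffix? (c ∷ x) with minimal-suffix? x
    ... | inj₁ (z , s , zs≡x , p , minimal) = inj₁ (c ∷ z , s , cong (c ∷_) zs≡x , p , minimal)
    ... | inj₂ none with P? (c ∷ x)
    ...   | yes p = inj₁ ([] , c ∷ x , refl , p , λ { [] _ z′≢[] _ → ⊥-elim (z′≢[] refl)
                                                  ; (_ ∷ z′) s′ _ eq → none z′ s′ (∷-injectiveʳ eq) })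
    ...   | no ¬p = inj₂ λ { [] s refl → ¬p ; (_ ∷ z) s eq → none z s (∷-injectiveʳ eq) }

module OrderedAlphabet {A : Set} (_≺A_ : A → A → Set) (sto : IsStrictTotalOrder _≡_ _≺A_) where

  open Words _≺A_
  open IsStrictTotalOrder sto using (compare; asym; _≟_; _<?_)
  open ≡-Reasoning

  private variable
    a b : A
    k n : ℕ
    ℓ m q s t u v w x x′ y y′ z X Y : Word
    cs : List Word

  ≺A-irrefl : ∀ {a} → ¬ a ≺A a
  ≺A-irrefl = IsStrictTotalOrder.irrefl sto refl

  prefix-refl : ∀ x → Prefix x x
  prefix-refl x = [] , ++-identityʳ x

  prefix-trans : Prefix x y → Prefix y z → Prefix x z
  prefix-trans {x} (u , refl) (v , refl) = u ++ v , sym (++-assoc x u v)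

  prefix-by-length : length x ≤ length y → Prefix x w → Prefix y w → Prefix x y
  prefix-by-length {[]}    {y}     _        _          _        = y , refl
  prefix-by-length {_ ∷ _} {[]}    ()       _          _
  prefix-by-length {c ∷ x} {_ ∷ y} (s≤s le) (u , refl) (v , eq) with ∷-injective eq
  ... | refl , eq′ = Product.map₂ (cong (c ∷_)) (prefix-by-length le (u , refl) (v , eq′))

  prefix-≢⇒properPrefix : Prefix x y → x ≢ y → ProperPrefix x y
  prefix-≢⇒properPrefix {x} ([] , refl) x≢y = ⊥-elim (x≢y (sym (++-identityʳ x)))
  prefix-≢⇒properPrefix (c ∷ u , eq) _ = c ∷ u , (λ ()) , eq

  prefix? : Decidable Prefix
  prefix? x y =
    map′ (λ eq → drop (length x) y
                 , trans (cong (_++ drop (length x) y) (sym eq)) (take++drop≡id (length x) y))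
         (λ (u , eq) → subst (λ y → take (length x) y ≡ x) eq (take-length-++ x u))
         (≡-dec _≟_ (take (length x) y) x)

  -- The second alternative of Lex R, as an inductive family.
  data Mismatch (R : A → A → Set) : Word → Word → Set where
    here  : ∀ {a b x y} → R a b → Mismatch R (a ∷ x) (b ∷ y)
    there : ∀ {c x y} → Mismatch R x y → Mismatch R (c ∷ x) (c ∷ y)

  module _ {R : A → A → Set} where

    mismatch-nonempty : Mismatch R x y → x ≢ [] × y ≢ []
    mismatch-nonempty (here _)  = (λ ()) , (λ ())
    mismatch-nonempty (there _) = (λ ()) , (λ ())

    mismatch-++ˡ : ∀ u → Mismatch R x y → Mismatch R (u ++ x) (u ++ y)
    mismatch-++ˡ []      mm = mm
    mismatch-++ˡ (_ ∷ u) mm = there (mismatch-++ˡ u mm)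

    mismatch-extend : Mismatch R x y → Prefix x x′ → Prefix y y′ → Mismatch R x′ y′
    mismatch-extend (here h)   (_ , refl) (_ , refl) = here h
    mismatch-extend (there mm) (u , refl) (v , refl) = there (mismatch-extend mm (u , refl) (v , refl))

    mismatch-flip : Mismatch R x y → Mismatch (flip R) y x
    mismatch-flip (here h)   = here h
    mismatch-flip (there mm) = there (mismatch-flip mm)

    mismatch-view : Mismatch R x y →
                    ∃ λ r → ∃ λ a → ∃ λ s → ∃ λ b → ∃ λ t → x ≡ r ++ (a ∷ s) × y ≡ r ++ (b ∷ t) × R a b
    mismatch-view (here {a} {b} {x} {y} h) = [] , a , x , b , y , refl , refl , h
    mismatch-view (there {c} mm) with mismatch-view mm
    ... | r , a , s , b , t , refl , refl , h = c ∷ r , a , s , b , t , refl , refl , h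

    mismatch⇒lex : Mismatch R x y → Lex R x y
    mismatch⇒lex = inj₂ ∘ mismatch-view

    lex⇒mismatch : length y ≤ length x → Lex R x y → Mismatch R x y
    lex⇒mismatch {x = x} y≤x (inj₁ (_ , z≢[] , refl)) = ⊥-elim (<⇒≱ (length-<-++ˡ x z≢[]) y≤x)
    lex⇒mismatch _ (inj₂ (r , _ , _ , _ , _ , refl , refl , h)) = mismatch-++ˡ r (here h)

    mismatch⇒¬prefix : (∀ {a} → ¬ R a a) → Mismatch R x y → ¬ Prefix x y
    mismatch⇒¬prefix irr (here h)   (_ , refl) = irr h
    mismatch⇒¬prefix irr (there mm) (u , eq)   = mismatch⇒¬prefix irr mm (u , ∷-injectiveʳ eq)

    mismatch-asym : (∀ {a b} → R a b → ¬ R b a) → Mismatch R x y → ¬ Mismatch R y x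
    mismatch-asym asy (here h)   (here h′)   = asy h h′
    mismatch-asym asy (here h)   (there _)   = asy h h
    mismatch-asym asy (there _)  (here h)    = asy h h
    mismatch-asym asy (there mm) (there mm′) = mismatch-asym asy mm mm′

    mismatch-cancelˡ : (∀ {a} → ¬ R a a) → ∀ u → Mismatch R (u ++ x) (u ++ y) → Mismatch R x y
    mismatch-cancelˡ irr []      mm         = mm
    mismatch-cancelˡ irr (_ ∷ _) (here h)   = ⊥-elim (irr h)
    mismatch-cancelˡ irr (_ ∷ u) (there mm) = mismatch-cancelˡ irr u mm

    mismatch-truncate : length s ≤ length y → Mismatch R (s ++ u) y′ → Prefix y y′ →
                        Mismatch R s y ⊎ Prefix s y
    mismatch-truncate {[]}    {y}     _        _          _          = inj₂ (y , refl)
    mismatch-truncate {_ ∷ _} {[]}    ()       _          _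
    mismatch-truncate {_ ∷ _} {_ ∷ _} _        (here h)   (_ , refl) = inj₁ (here h)
    mismatch-truncate {c ∷ _} {_ ∷ _} (s≤s le) (there mm) (v , refl) =
      Sum.map there (Product.map₂ (cong (c ∷_))) (mismatch-truncate le mm (v , refl))

  _⪯_ : Word → Word → Set
  x ⪯ y = Prefix x y ⊎ Mismatch _≺A_ x y

  ⪯-extend : x ⪯ y → Prefix y y′ → x ⪯ y′
  ⪯-extend (inj₁ x≤y) y≤y′ = inj₁ (prefix-trans x≤y y≤y′)
  ⪯-extend (inj₂ mm)  y≤y′ = inj₂ (mismatch-extend mm (prefix-refl _) y≤y′)

  ⪯-truncate : length s ≤ length y → (s ++ u) ⪯ y′ → Prefix y y′ → s ⪯ y
  ⪯-truncate {u = u} le (inj₁ su≤y′) y≤y′ = inj₁ (prefix-by-length le (prefix-trans (u , refl) su≤y′) y≤y′)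
  ⪯-truncate le (inj₂ mm) y≤y′ = Sum.swap (mismatch-truncate le mm y≤y′)

  ⪯⇒≺ : length x < length y → x ⪯ y → x ≺ y
  ⪯⇒≺ x<y (inj₁ x≤y) = inj₁ (prefix-≢⇒properPrefix x≤y λ x≡y → <-irrefl (cong length x≡y) x<y)
  ⪯⇒≺ _   (inj₂ mm)  = mismatch⇒lex mm

  mismatch⇒≪ : Mismatch _≺A_ x y → x ≪ y
  mismatch⇒≪ mm = proj₁ (mismatch-nonempty mm) , proj₂ (mismatch-nonempty mm) , mismatch⇒lex mm
                , λ (z , _ , eq) → mismatch⇒¬prefix ≺A-irrefl mm (z , eq)

  mismatch⇒¬≻ : Mismatch _≺A_ x y → ¬ (y ≺ x)
  mismatch⇒¬≻ mm (inj₁ (z , _ , eq)) = mismatch⇒¬prefix ≺A-irrefl (mismatch-flip mm) (z , eq)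
  mismatch⇒¬≻ mm (inj₂ (r , _ , _ , _ , _ , refl , refl , h)) =
    mismatch-asym asym mm (mismatch-++ˡ r (here h))

  mismatched-suffix⇒¬invLyndon : z ≢ [] → z ++ y ≡ x → Mismatch _≺A_ x y → ¬ InvLyndon x
  mismatched-suffix⇒¬invLyndon z≢[] zy≡x mm (_ , suffix≺) =
    mismatch⇒¬≻ mm (suffix≺ _ (proj₂ (mismatch-nonempty mm) , _ , z≢[] , zy≡x))

  -- Anti-Lyndon words

  primitive-rotation-≢ : Primitive ℓ → ℓ ≡ u ++ v → u ≢ [] → v ≢ [] → v ++ u ≢ ℓ
  primitive-rotation-≢ {u = u} {v} prim refl u≢[] v≢[] vu≡uv with commuting⇒powers u v (sym vu≡uv)
  ... | r , m , n , refl , refl with m | n | prim r (m + n) (sym (power-+ r m n))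
  ... | zero        | _     | _  = u≢[] refl
  ... | suc zero    | zero  | _  = v≢[] refl
  ... | suc zero    | suc _ | ()
  ... | suc (suc _) | _     | ()

  antiLyndon-rotation : AntiLyndon ℓ → ℓ ≡ u ++ v → u ≢ [] → v ≢ [] → Mismatch _≺A_ (v ++ u) ℓ
  antiLyndon-rotation {ℓ} {u} {v} (_ , prim , least) ℓ≡uv u≢[] v≢[] =
    mismatch-flip (lex⇒mismatch (≤-reflexive (trans (length-++-comm v u) (cong length (sym ℓ≡uv))))
                                (least u v ℓ≡uv (primitive-rotation-≢ prim ℓ≡uv u≢[] v≢[])))

  antiLyndon-unbordered : AntiLyndon ℓ → z ≢ [] → t ≢ [] → z ++ t ≡ ℓ → ¬ Prefix t ℓ
  antiLyndon-unbordered {z = z} {t} _ z≢[] _ refl ([] , t≡zt) =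
    z≢[] (++-identityˡ-unique z (trans (sym (++-identityʳ t)) t≡zt))
  antiLyndon-unbordered {z = z} {t} al z≢[] t≢[] refl (y@(_ ∷ _) , ty≡zt) =
    Sum.[ mismatch-asym asym z⊏y , mismatch⇒¬prefix ≺A-irrefl (mismatch-flip z⊏y) ]
      (mismatch-truncate (≤-reflexive |y|≡|z|) (antiLyndon-rotation al (sym ty≡zt) t≢[] (λ ())) (t , refl))
    where
    |y|≡|z| : length y ≡ length z
    |y|≡|z| = +-cancelˡ-≡ (length t) _ _ (begin
      length t + length y ≡⟨ length-++ t ⟨
      length (t ++ y)     ≡⟨ cong length ty≡zt ⟩
      length (z ++ t)     ≡⟨ length-++-comm z t ⟩
      length (t ++ z)     ≡⟨ length-++ t ⟩
      length t + length z ∎)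
    z⊏y : Mismatch _≺A_ z y
    z⊏y = mismatch-cancelˡ ≺A-irrefl t
            (subst (Mismatch _≺A_ (t ++ z)) (sym ty≡zt) (antiLyndon-rotation al refl z≢[] t≢[]))

  SuffixesBelow : Word → Set
  SuffixesBelow ℓ = ∀ z t → z ≢ [] → t ≢ [] → z ++ t ≡ ℓ → Mismatch _≺A_ t ℓ

  antiLyndon⇒suffixesBelow : AntiLyndon ℓ → SuffixesBelow ℓ
  antiLyndon⇒suffixesBelow al z t z≢[] t≢[] refl
    with mismatch-truncate (length-++-≤ʳ t {z}) (antiLyndon-rotation al refl z≢[] t≢[]) (prefix-refl _)
  ... | inj₁ t⊏ℓ = t⊏ℓ
  ... | inj₂ t≤ℓ = ⊥-elim (antiLyndon-unbordered al z≢[] t≢[] refl t≤ℓ)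

  suffix-of-power : SuffixesBelow ℓ → ∀ n → z ≢ [] → z ++ t ≡ power ℓ n → t ⪯ power ℓ n
  suffix-of-power {z = []}    _ zero z≢[] _ = ⊥-elim (z≢[] refl)
  suffix-of-power {z = _ ∷ _} _ zero _    ()
  suffix-of-power {ℓ} {z} {t} below (suc n) z≢[] eq with levi z t ℓ (power ℓ n) eq
  ... | inj₁ ([] , _ , refl) = inj₁ (ℓ , sym (power-sucʳ ℓ n))
  ... | inj₁ (e@(_ ∷ _) , ℓ≡ze , refl) =
    inj₂ (mismatch-extend (below z e z≢[] (λ ()) (sym ℓ≡ze)) (power ℓ n , refl) (power ℓ n , refl))
  ... | inj₂ (_ , _ , _ , ℓⁿ≡xet) =
    ⪯-extend (suffix-of-power below n (λ ()) (sym ℓⁿ≡xet)) (ℓ , sym (power-sucʳ ℓ n))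

  prefix-of-power-invLyndon : SuffixesBelow ℓ → ∀ n → y ≢ [] → Prefix y (power ℓ n) → InvLyndon y
  prefix-of-power-invLyndon {ℓ} {y} below n y≢[] y≤ℓⁿ@(u , yu≡ℓⁿ) = y≢[] , suffix≺
    where
    suffix≺ : ∀ s → NonemptyProperSuffix s y → s ≺ y
    suffix≺ s (_ , z , z≢[] , zs≡y) =
      ⪯⇒≺ s<y (⪯-truncate (<⇒≤ s<y) (suffix-of-power below n z≢[] zsu≡ℓⁿ) y≤ℓⁿ)
      where
      s<y : length s < length y
      s<y = subst (λ y → length s < length y) zs≡y (length-<-++ʳ s z≢[])
      zsu≡ℓⁿ : z ++ s ++ u ≡ power ℓ n
      zsu≡ℓⁿ = trans (sym (++-assoc z s u)) (trans (cong (_++ u) zs≡y) yu≡ℓⁿ)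

  power-++-prefix : Prefix x ℓ → Prefix (power ℓ n ++ x) (power ℓ (suc n))
  power-++-prefix {x} {n = n} (u , refl) =
    u , trans (++-assoc (power (x ++ u) n) x u) (sym (power-sucʳ (x ++ u) n))

  -- Canonical pairs

  InvLyndonPrefixes : Word → Set
  InvLyndonPrefixes x = ∀ y → y ≢ [] → Prefix y x → InvLyndon y

  invLyndon-suffix : InvLyndon u → z ≢ [] → z ++ q ≡ u → q ≺ u
  invLyndon-suffix {q = []}    (u≢[] , _)    _    _  = inj₁ (_ , u≢[] , refl)
  invLyndon-suffix {q = _ ∷ _} (_ , suffix≺) z≢[] eq = suffix≺ _ ((λ ()) , _ , z≢[] , eq)

  ∷ʳ-suffix : t ≢ [] → z ++ t ≡ u ∷ʳ b → ∃ λ q → t ≡ q ∷ʳ b × z ++ q ≡ u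
  ∷ʳ-suffix {t} {z} {u} t≢[] eq with levi z t u _ eq
  ... | inj₁ (q , u≡zq , t≡qb)  = q , t≡qb , sym u≡zq
  ... | inj₂ (_ , e , _ , b∷[]≡) = ⊥-elim (t≢[] (++-conicalʳ e t (sym (∷-injectiveʳ b∷[]≡))))

  ∷ʳ-invLyndon : (∀ z q → z ≢ [] → z ++ q ≡ u → (q ∷ʳ b) ≺ (u ∷ʳ b)) → InvLyndon (u ∷ʳ b)
  ∷ʳ-invLyndon {u} suffix≺ = ++-∷≢[] u , λ t (t≢[] , z , z≢[] , zt≡ub) →
    let q , t≡qb , zq≡u = ∷ʳ-suffix t≢[] zt≡ub in subst (_≺ _) (sym t≡qb) (suffix≺ z q z≢[] zq≡u)

  ≺-∷ʳ : q ≺ u → (∀ c y → u ≡ q ++ c ∷ y → ¬ c ≺A b) → (q ∷ʳ b) ≺ (u ∷ʳ b)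
  ≺-∷ʳ (inj₁ ([] , []≢[] , _)) _ = ⊥-elim ([]≢[] refl)
  ≺-∷ʳ {q} {b = b} (inj₁ (c ∷ y , _ , refl)) not-below with compare c b
  ... | tri< c≺b _ _ = ⊥-elim (not-below c y refl c≺b)
  ... | tri≈ _ refl _ =
    inj₁ (y ∷ʳ c , ++-∷≢[] y , trans (++-assoc q [ c ] (y ∷ʳ c)) (sym (++-assoc q (c ∷ y) [ c ])))
  ... | tri> _ _ b≺c = inj₂ (q , b , [] , c , y ∷ʳ b , refl , ++-assoc q (c ∷ y) [ b ] , b≺c)
  ≺-∷ʳ {b = b} (inj₂ (r , c , s , d , t , refl , refl , h)) _ =
    inj₂ (r , c , s ∷ʳ b , d , t ∷ʳ b , ++-assoc r (c ∷ s) [ b ] , ++-assoc r (d ∷ t) [ b ] , h)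

  FollowedBelow : Word → A → Word → Set
  FollowedBelow x b s = ∃₂ λ c y → x ≡ s ++ c ∷ y × c ≺A b

  followedBelow? : ∀ x b s → Dec (FollowedBelow x b s)
  followedBelow? []      b []      = no λ { (_ , _ , () , _) }
  followedBelow? (c ∷ x) b []      =
    map′ (λ c≺b → c , x , refl , c≺b) (λ { (_ , _ , refl , c≺b) → c≺b }) (c <? b)
  followedBelow? []      b (_ ∷ _) = no λ { (_ , _ , () , _) }
  followedBelow? (c ∷ x) b (d ∷ s) with c ≟ d
  ... | no c≢d  = no λ { (_ , _ , refl , _) → c≢d refl }
  ... | yes refl = map′ (λ (e , y , eq , h) → e , y , cong (c ∷_) eq , h)
                        (λ (e , y , eq , h) → e , y , ∷-injectiveʳ eq , h)
                        (followedBelow? x b s)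

  period-nonempty : z ++ s ≡ s ++ a ∷ y → z ≢ []
  period-nonempty {[]} {s} eq _ with ++-identityʳ-unique s eq
  ... | ()
  period-nonempty {_ ∷ _} _ ()

  minimal-border-short : z ≢ [] → z ++ s ≡ s ++ a ∷ y → a ≺A b →
                         (∀ z′ s′ → z′ ≢ [] → z′ ++ s′ ≡ s → ¬ FollowedBelow (z ++ s) b s′) →
                         ∃ λ e → z ≡ s ++ a ∷ e
  minimal-border-short {z} {s} {a} {y} z≢[] x≡say a≺b minimal with levi z s s (a ∷ y) x≡say
  ... | inj₁ (e , s≡ze , s≡eay) =
    ⊥-elim (minimal z e z≢[] (sym s≡ze)
             (a , y ++ a ∷ y
                , trans x≡say (trans (cong (_++ a ∷ y) s≡eay) (++-assoc e (a ∷ y) (a ∷ y))) , a≺b))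
  ... | inj₂ (_ , e , z≡sce , ay≡ces) with ∷-injective ay≡ces
  ...   | refl , _ = e , z≡sce

  minimal-follower-canonical-pair :
    InvLyndonPrefixes (z ++ s) → ¬ InvLyndon ((z ++ s) ∷ʳ b) → z ++ s ≡ s ++ a ∷ y → a ≺A b →
    (∀ z′ s′ → z′ ≢ [] → z′ ++ s′ ≡ s → ¬ FollowedBelow (z ++ s) b s′) →
    Prefix ((z ++ s) ∷ʳ b) w → CanonicalPair w z (s ∷ʳ b)
  minimal-follower-canonical-pair {z} {s} {b} {a} {y} {w} prefixes ¬IL x≡say a≺b minimal (v , xbv≡w) =
    (s ∷ʳ b) ++ v , w≡ , z≢[] , ++-∷≢[] s ∘ ++-conicalˡ (s ∷ʳ b) v , prefixes z z≢[] (s , refl)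
    , ++-∷≢[] s , (v , refl) , sb-invLyndon , zz′-invLyndon
    , ¬IL ∘ subst InvLyndon (sym (++-assoc z s [ b ])) , z≪sb
    where
    z≢[] : z ≢ []
    z≢[] = period-nonempty x≡say
    w≡ : w ≡ z ++ (s ∷ʳ b) ++ v
    w≡ = trans (sym xbv≡w) (solve (++-monoid A))
    z≪sb : z ≪ (s ∷ʳ b)
    z≪sb with minimal-border-short z≢[] x≡say a≺b minimal
    ... | e , refl = mismatch⇒≪ (mismatch-++ˡ s (here a≺b))
    sb-invLyndon : InvLyndon (s ∷ʳ b)
    sb-invLyndon = ∷ʳ-invLyndon λ z′ q z′≢[] z′q≡s →
      let s≢[] : s ≢ []
          s≢[] s≡[] = z′≢[] (++-conicalˡ z′ q (trans z′q≡s s≡[]))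
      in ≺-∷ʳ (invLyndon-suffix (prefixes s s≢[] (a ∷ y , sym x≡say)) z′≢[] z′q≡s)
              λ c y′ s≡qcy′ c≺b → minimal z′ q z′≢[] z′q≡s
                (c , y′ ++ a ∷ y
                   , trans x≡say (trans (cong (_++ a ∷ y) s≡qcy′) (++-assoc q (c ∷ y′) (a ∷ y))) , c≺b)
    zz′-invLyndon : ∀ z′ → z′ ≢ [] → ProperPrefix z′ (s ∷ʳ b) → InvLyndon (z ++ z′)
    zz′-invLyndon z′ _ (_ , f≢[] , z′f≡sb) =
      let g , _ , z′g≡s = ∷ʳ-suffix f≢[] z′f≡sb
      in prefixes (z ++ z′) (z≢[] ∘ ++-conicalˡ z z′) (g , trans (++-assoc z z′ g) (cong (z ++_) z′g≡s))

  -- p̄ = s b for the shortest suffix s of x that is followed in x by a letter below b.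
  canonical-pair : x ≢ [] → InvLyndonPrefixes x → ¬ InvLyndon (x ∷ʳ b) → Prefix (x ∷ʳ b) w →
                   ∃₂ λ p pbar → CanonicalPair w p pbar × p ++ pbar ≡ x ∷ʳ b
  canonical-pair {x} {b} x≢[] prefixes ¬IL xb≤w with minimal-suffix? (followedBelow? x b) x
  ... | inj₁ (z , s , refl , (_ , _ , x≡say , a≺b) , minimal) =
    z , s ∷ʳ b , minimal-follower-canonical-pair prefixes ¬IL x≡say a≺b minimal xb≤w
    , sym (++-assoc z s [ b ])
  ... | inj₂ none = ⊥-elim (¬IL (∷ʳ-invLyndon λ z q z≢[] zq≡x →
    ≺-∷ʳ (invLyndon-suffix (prefixes x x≢[] (prefix-refl x)) z≢[] zq≡x)
         λ c y x≡qcy c≺b → none z q zq≡x (c , y , x≡qcy , c≺b)))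

  -- Prefix chains of factors of an anti-Lyndon word

  overshoot-canonical-pair : SuffixesBelow ℓ → ℓ ≡ Y ++ a ∷ s → a ≺A b →
                             Prefix ((power ℓ (suc k) ++ Y) ∷ʳ b) w →
                             ∃₂ λ p pbar → CanonicalPair w p pbar × p ++ pbar ≡ (power ℓ (suc k) ++ Y) ∷ʳ b
  overshoot-canonical-pair {Y = Y} {a} {s} {b} {k} below refl a≺b =
    canonical-pair (P≢[] ∘ ++-conicalˡ P Y) prefixes
      (mismatched-suffix⇒¬invLyndon P≢[] (sym (++-assoc P Y [ b ])) mismatch)
    where
    P : Word
    P = power (Y ++ a ∷ s) (suc k)
    P≢[] : P ≢ []
    P≢[] = ++-∷≢[] Y ∘ ++-conicalˡ _ _
    prefixes : InvLyndonPrefixes (P ++ Y)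
    prefixes y y≢[] y≤PY = prefix-of-power-invLyndon below (suc (suc k)) y≢[]
      (prefix-trans y≤PY (a ∷ s , trans (++-assoc P Y (a ∷ s)) (sym (power-sucʳ (Y ++ a ∷ s) (suc k)))))
    mismatch : Mismatch _≺A_ ((P ++ Y) ∷ʳ b) (Y ∷ʳ b)
    mismatch = mismatch-extend (mismatch-++ˡ Y (here {x = s} {y = []} a≺b))
                               (power (Y ++ a ∷ s) k ++ Y ∷ʳ b , solve (++-monoid A)) (prefix-refl _)

  -- Items (4) and (5) for ℓ = ℓ₁, X = ℓ_{i+1}⋯ℓ_j, m = ℓ_{j+1} and P = ℓ₁⋯ℓ_i.
  ChainBreak : Word → Word → Word → Word → Word → Set
  ChainBreak ℓ X m P w =
    ∃ λ r → ∃ λ s → ∃ λ s′ → ∃ λ a → ∃ λ b →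
      a ≺A b × ℓ ≡ X ++ (r ++ (a ∷ s)) × m ≡ r ++ (b ∷ s′)
      × (∃ λ p → ∃ λ pbar → CanonicalPair w p pbar × p ++ pbar ≡ P ++ (X ++ (r ++ (b ∷ []))))

  chainBreak⇒≪ : ∀ {P} → ChainBreak ℓ X m P w → ℓ ≪ (X ++ m)
  chainBreak⇒≪ {X = X} (r , _ , _ , _ , _ , a≺b , refl , refl , _) =
    mismatch⇒≪ (mismatch-++ˡ X (mismatch-++ˡ r (here a≺b)))

  chain-break : SuffixesBelow ℓ → X ≢ [] → ProperPrefix X ℓ → Prefix m ℓ → ¬ Prefix (X ++ m) ℓ →
                Prefix (power ℓ (suc k) ++ X ++ m) w → ChainBreak ℓ X m (power ℓ (suc k)) w
  chain-break {ℓ} {X} {m} {k} {w} below X≢[] (t , t≢[] , Xt≡ℓ) (f , mf≡ℓ) Xm≰ℓ Xm≤w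
    with mismatch-view (below X t X≢[] t≢[] Xt≡ℓ)
  ... | r , a , s , b , s₂ , refl , ℓ≡rbs₂ , a≺b with levi m f r (b ∷ s₂) (trans mf≡ℓ ℓ≡rbs₂)
  ... | inj₁ (g , refl , _) = ⊥-elim (Xm≰ℓ (g ++ a ∷ s , (begin
    (X ++ m) ++ g ++ a ∷ s   ≡⟨ solve (++-monoid A) ⟩
    X ++ (m ++ g) ++ a ∷ s   ≡⟨ Xt≡ℓ ⟩
    ℓ                        ∎)))
  ... | inj₂ (_ , s′ , refl , b∷s₂≡) with ∷-injective b∷s₂≡
  ...   | refl , _ = r , s , s′ , a , b , a≺b , sym Xt≡ℓ , refl , canonical
    where
    Xrb≤Xm : Prefix ((power ℓ (suc k) ++ X ++ r) ∷ʳ b) (power ℓ (suc k) ++ X ++ r ++ b ∷ s′)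
    Xrb≤Xm = s′ , solve (++-monoid A)
    canonical : ∃₂ λ p pbar → CanonicalPair w p pbar × p ++ pbar ≡ power ℓ (suc k) ++ X ++ r ++ b ∷ []
    canonical with overshoot-canonical-pair {k = k} below (trans (sym Xt≡ℓ) (sym (++-assoc X r (a ∷ s))))
                                             a≺b (prefix-trans Xrb≤Xm Xm≤w)
    ... | p , pbar , pair , p·pbar≡ = p , pbar , pair , trans p·pbar≡ (solve (++-monoid A))

  ++-concat-prefixes-≢ : AntiLyndon ℓ → m ≢ [] → m ≢ ℓ → All (λ v → v ≢ [] × Prefix v ℓ) cs →
                         m ++ concat cs ≢ ℓ
  ++-concat-prefixes-≢ {m = m} {cs} al m≢[] m≢ℓ facts with reverseView cs
  ... | [] = m≢ℓ ∘ trans (sym (++-identityʳ m))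
  ... | cs′ ∶ _ ∶ʳ v with AllP.++⁻ʳ cs′ facts
  ...   | (v≢[] , v≤ℓ) ∷ [] = λ eq →
    antiLyndon-unbordered al (m≢[] ∘ ++-conicalˡ m (concat cs′)) v≢[]
      (trans (++-assoc m (concat cs′) v) (trans (cong (m ++_) (sym (concat-∷ʳ cs′ v))) eq)) v≤ℓ

  chain-shape :
    AntiLyndon ℓ → All (λ v → v ≢ [] × Prefix v ℓ) cs → ¬ InvLyndon (concat (ℓ ∷ cs)) →
    ∃ λ k → ∃ λ m₁ → ∃ λ d → ∃ λ m → ∃ λ e →
      cs ≡ replicate k ℓ ++ (m₁ ∷ d) ++ m ∷ e × m₁ ≢ ℓ × concat (m₁ ∷ d) ≢ []
      × ProperPrefix (concat (m₁ ∷ d)) ℓ × Prefix m ℓ × ¬ Prefix (concat (m₁ ∷ d) ++ m) ℓ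
  chain-shape {ℓ} {cs} al facts ¬IL with replicate-span (≡-dec _≟_) ℓ cs
  ... | k , inj₁ refl =
    ⊥-elim (¬IL (prefix-of-power-invLyndon (antiLyndon⇒suffixesBelow al) (suc k)
                                           (proj₁ al ∘ ++-conicalˡ ℓ _) (prefix-refl _)))
  ... | k , inj₂ (m₁ , c , refl , m₁≢ℓ) with AllP.++⁻ʳ (replicate k ℓ) facts
  ...   | (m₁≢[] , m₁≤ℓ) ∷ c-facts with greedy-split (λ u → prefix? u ℓ) m₁ c m₁≤ℓ
  ...     | d , X≤ℓ , inj₁ refl =
    ⊥-elim (¬IL (prefix-of-power-invLyndon (antiLyndon⇒suffixesBelow al) (suc (suc k))
                                           (proj₁ al ∘ ++-conicalˡ ℓ _)
                  (subst (λ u → Prefix u _) (concat-++ (replicate (suc k) ℓ) (m₁ ∷ d))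
                         (power-++-prefix {n = suc k} X≤ℓ))))
  ...     | d , X≤ℓ , inj₂ (m , e , refl , Xm≰ℓ) with AllP.++⁻ʳ d c-facts
  ...       | (_ , m≤ℓ) ∷ _ =
    k , m₁ , d , m , e , refl , m₁≢ℓ , m₁≢[] ∘ ++-conicalˡ m₁ _
    , prefix-≢⇒properPrefix X≤ℓ (++-concat-prefixes-≢ al m₁≢[] m₁≢ℓ (AllP.++⁻ˡ d c-facts)) , m≤ℓ , Xm≰ℓ

  concat-prefix : ∀ (P D : List Word) m L → Prefix (concat P ++ concat D ++ m) (concat (P ++ D ++ m ∷ L))
  concat-prefix P D m L = concat L , (begin
    (concat P ++ concat D ++ m) ++ concat L ≡⟨ solve (++-monoid A) ⟩
    concat P ++ concat D ++ m ++ concat L   ≡⟨ cong (concat P ++_) (concat-++ D (m ∷ L)) ⟩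
    concat P ++ concat (D ++ m ∷ L)         ≡⟨ concat-++ P (D ++ m ∷ L) ⟩
    concat (P ++ D ++ m ∷ L)                ∎)

  at-replicate-++ : ∀ n {L} k → 1 ≤ k → k ≤ length (replicate n x) → at (replicate n x ++ L) k ≡ x
  at-replicate-++ _       zero          ()      _
  at-replicate-++ zero    (suc _)       _       ()
  at-replicate-++ (suc n) (suc zero)    _       _          = refl
  at-replicate-++ (suc n) (suc (suc k)) _       (s≤s k<n) = at-replicate-++ n (suc k) (s≤s z≤n) k<n

  at-after : ∀ (P : List Word) {L} → at (P ++ x ∷ L) (suc (length P)) ≡ x
  at-after []      = refl
  at-after (_ ∷ P) = at-after P

  seg-infix : ∀ (P D L : List Word) → seg (P ++ D ++ L) (suc (length P)) (length (P ++ D)) ≡ concat D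
  seg-infix []      D L = cong concat (take-length-++ D L)
  seg-infix (_ ∷ P) D L = seg-infix P D L

  seg-infix-∷ : ∀ (P D : List Word) m L →
                seg (P ++ D ++ m ∷ L) (suc (length P)) (suc (length (P ++ D))) ≡ concat D ++ m
  seg-infix-∷ []      D m L = trans (cong concat (take-length-++-∷ D m L)) (concat-∷ʳ D m)
  seg-infix-∷ (_ ∷ P) D m L = seg-infix-∷ P D m L

  Conclusion : List Word → Word → Set
  Conclusion c w =
    (2 < length c)
    × (∃ λ i → ∃ λ j → 1 ≤ i × i < j × j < length c
        × (∀ k → 1 ≤ k → k ≤ i → at c k ≡ at c 1)
        × at c i ≢ at c (suc i)
        × Prefix (seg c (suc i) j) (at c 1)
        × ¬ Prefix (seg c (suc i) (suc j)) (at c 1)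
        × at c 1 ≪ seg c (suc i) (suc j)
        × ChainBreak (at c 1) (seg c (suc i) j) (at c (suc j)) (seg c 1 i) w)

  conclusion-intro :
    ∀ {c P} i j → 1 ≤ i → i < j → j < length c →
    (∀ k → 1 ≤ k → k ≤ i → at c k ≡ ℓ) → ℓ ≢ at c (suc i) →
    seg c 1 i ≡ P → seg c (suc i) j ≡ X → at c (suc j) ≡ m → seg c (suc i) (suc j) ≡ X ++ m →
    Prefix X ℓ → ¬ Prefix (X ++ m) ℓ → ChainBreak ℓ X m P w → Conclusion c w
  conclusion-intro {c = c} i j 1≤i i<j j<c run ℓ≢ refl refl refl Xm≡ X≤ℓ Xm≰ℓ break with run 1 ≤-refl 1≤i
  ... | refl =
    ≤-trans (s≤s (≤-trans (s≤s 1≤i) i<j)) j<c , i , j , 1≤i , i<j , j<c , run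
    , (λ eq → ℓ≢ (trans (sym (run i 1≤i ≤-refl)) eq)) , X≤ℓ
    , subst (λ Y → ¬ Prefix Y _) (sym Xm≡) Xm≰ℓ
    , subst (_ ≪_) (sym Xm≡) (chainBreak⇒≪ {P = seg c 1 i} break) , break

  chain-conclusion : ∀ {m₁ d e} k → m₁ ≢ ℓ →
                     Prefix (concat (m₁ ∷ d)) ℓ → ¬ Prefix (concat (m₁ ∷ d) ++ m) ℓ →
                     ChainBreak ℓ (concat (m₁ ∷ d)) m (power ℓ (suc k)) w →
                     Conclusion (replicate (suc k) ℓ ++ (m₁ ∷ d) ++ m ∷ e) w
  chain-conclusion {ℓ} {m} {m₁ = m₁} {d} {e} k m₁≢ℓ X≤ℓ Xm≰ℓ break =
    conclusion-intro (length P) (length (P ++ D)) (s≤s z≤n) (length-<-++ˡ P (λ ())) j<c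
      (at-replicate-++ (suc k)) (λ eq → m₁≢ℓ (trans (sym (at-after P)) (sym eq)))
      (cong concat (take-length-++ P _)) (seg-infix P D _) at-j (seg-infix-∷ P D m e) X≤ℓ Xm≰ℓ break
    where
    P D : List Word
    P = replicate (suc k) ℓ
    D = m₁ ∷ d
    j<c : length (P ++ D) < length (P ++ D ++ m ∷ e)
    j<c = subst (λ c → length (P ++ D) < length c) (++-assoc P D (m ∷ e)) (length-<-++ˡ (P ++ D) (λ ()))
    at-j : at (P ++ D ++ m ∷ e) (suc (length (P ++ D))) ≡ m
    at-j = subst (λ c → at c (suc (length (P ++ D))) ≡ m) (++-assoc P D (m ∷ e)) (at-after (P ++ D))

  prefix-chain-conclusion : AntiLyndon ℓ → All (λ v → v ≢ [] × Prefix v ℓ) cs → Prefix (concat (ℓ ∷ cs)) w →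
                            ¬ InvLyndon (concat (ℓ ∷ cs)) → Conclusion (ℓ ∷ cs) w
  prefix-chain-conclusion {ℓ} al facts c≤w ¬IL with chain-shape al facts ¬IL
  ... | k , m₁ , d , m , e , refl , m₁≢ℓ , X≢[] , X<ℓ , m≤ℓ , Xm≰ℓ =
    chain-conclusion k m₁≢ℓ X≤ℓ Xm≰ℓ
      (chain-break {k = k} (antiLyndon⇒suffixesBelow al) X≢[] X<ℓ m≤ℓ Xm≰ℓ
                   (prefix-trans (concat-prefix (replicate (suc k) _) (m₁ ∷ d) m e) c≤w))
    where
    X≤ℓ : Prefix (concat (m₁ ∷ d)) ℓ
    X≤ℓ = Product.map₂ proj₂ X<ℓ

proposition9p9 :
  ∀ {A : Set} (_≺A_ : A → A → Set) →
  IsStrictTotalOrder _≡_ _≺A_ →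
  (Σ (List A) λ xs → ∀ x → x ∈ xs) →
  let open Words _≺A_ in
  ∀ (w : Word) → w ≢ [] →
  ∀ (ls : List Word) → IsCFLin w ls →
  ∀ (c : List Word) → InitialMaximalChain ls c →
  ¬ InvLyndon (seg c 1 (length c)) →
  (2 < length c)
  × (∃ λ i → ∃ λ j → 1 ≤ i × i < j × j < length c
      × (∀ k → 1 ≤ k → k ≤ i → at c k ≡ at c 1)
      × at c i ≢ at c (suc i)
      × Prefix (seg c (suc i) j) (at c 1)
      × ¬ Prefix (seg c (suc i) (suc j)) (at c 1)
      × at c 1 ≪ seg c (suc i) (suc j)
      × (∃ λ r → ∃ λ s → ∃ λ s' → ∃ λ a → ∃ λ b →
           a ≺A b
           × at c 1 ≡ seg c (suc i) j ++ (r ++ (a ∷ s))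
           × at c (suc j) ≡ r ++ (b ∷ s')
           × (∃ λ p → ∃ λ pbar → CanonicalPair w p pbar
                × p ++ pbar ≡ seg c 1 i ++ (seg c (suc i) j ++ (r ++ (b ∷ []))))))
proposition9p9 _ _ _ _ _ _ _ [] (c≢[] , _) _ = ⊥-elim (c≢[] refl)
proposition9p9 _≺A_ sto _ w _ _ (antiLyndons , concat≡w , _) (ℓ ∷ cs) (_ , chain , rest , refl , _) ¬IL =
  prefix-chain-conclusion (All.head chain-antiLyndon)
    (All.zip ( All.map proj₁ (All.tail chain-antiLyndon)
             , All.tail (Linked⇒All (flip prefix-trans) (prefix-refl ℓ) chain)))
    (concat rest , trans (concat-++ (ℓ ∷ cs) rest) concat≡w)
    (¬IL ∘ subst InvLyndon (sym (cong concat (take-all _ (ℓ ∷ cs) ≤-refl))))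
  where
  open Words _≺A_
  open OrderedAlphabet _≺A_ sto
  chain-antiLyndon : All AntiLyndon (ℓ ∷ cs)
  chain-antiLyndon = AllP.++⁻ˡ (ℓ ∷ cs) antiLyndons
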